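{- For every projective plane $\Pi_q$ of order $q$ and every integer $r$ with $3\le r<\frac{q}{2}+2$, $M_r(\Pi_q)=q(r-1)+1$.
   Context: A finite projective plane $\Pi_q$ of order $q\ge 2$ has $q^2+q+1$ points and $q^2+q+1$ lines; every line contains $q+1$ points, every point lies on $q+1$ lines, any two lines meet in exactly one point and any two points lie on exactly one line. $r$-neighbor line percolation: for a set $A$ of points let $A^0=A$ and for $s\ge1$ let $A^s=A^{s-1}\cup\{P: \exists \text{ line } l\ni P \text{ with } |l\cap A^{s-1}|\ge r\}$; $A$ percolates if $A^k$ equals the whole point set for some $k$. $M_r(\Pi_q)$ is the maximum size of a set of points that does not percolate. -}

module Defs where

open import Data.Nat using (ℕ; zero; suc; _+_; _*_; _≤_; _≤ᵇ_)
open import Data.Fin using (Fin)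
open import Data.Fin.Subset using (Subset; _∈_; _∩_; _∪_; ∣_∣; ⊤)
open import Data.Vec using (lookup; tabulate)
open import Data.List using (allFin)
open import Data.Bool.ListAction using (any)
open import Data.Bool using (Bool; _∧_)
open import Data.Product using (Σ; ∃; _×_)
open import Relation.Binary.PropositionalEquality using (_≡_; _≢_)
open import Relation.Nullary using (¬_)

size : ℕ → ℕ
size q = q * q + q + 1

-- A projective plane of order q: points and lines are both indexed by
-- Fin (q²+q+1); each line is given by its set of points.
record ProjectivePlane (q : ℕ) : Set where
  field
    line : Fin (size q) → Subset (size q)
    line-size : ∀ l → ∣ line l ∣ ≡ suc q
    point-degree : ∀ P → ∣ tabulate (λ l → lookup (line l) P) ∣ ≡ suc q
    lines-meet : ∀ l m → l ≢ m → ∣ line l ∩ line m ∣ ≡ 1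
    points-join : ∀ P Q → P ≢ Q →
      ∣ tabulate (λ l → lookup (line l) P ∧ lookup (line l) Q) ∣ ≡ 1

module _ {q : ℕ} (Π : ProjectivePlane q) (r : ℕ) where
  open ProjectivePlane Π

  step : Subset (size q) → Subset (size q)
  step A = A ∪ tabulate (λ P →
    any (λ l → lookup (line l) P ∧ (r ≤ᵇ ∣ line l ∩ A ∣)) (allFin (size q)))

  iter : ℕ → Subset (size q) → Subset (size q)
  iter zero    A = A
  iter (suc k) A = step (iter k A)

  Percolates : Subset (size q) → Set
  Percolates A = ∃ λ k → iter k A ≡ ⊤

  IsMaxNonPercolating : ℕ → Set
  IsMaxNonPercolating m =
    (Σ (Subset (size q)) λ A → ¬ Percolates A × ∣ A ∣ ≡ m) ×
    (∀ (A : Subset (size q)) → ¬ Percolates A → ∣ A ∣ ≤ m)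

module Submission where

-- A set of points that does not percolate lies in a closed set B (every line meeting B in at
-- least r = k + 1 points lies in B) that misses some point X. Summing ∣ l ∩ B ∣ over the q + 1
-- lines l through X gives ∣ B ∣ ≤ (q + 1) k. If ∣ B ∣ ≥ q k + 2, the same sum over the lines
-- through a point of B shows that every point of B lies on two lines meeting B in more than k
-- points. So B contains a line G and, through each point P of G, a second line H P ⊆ B. If m Q
-- is the number of these q + 1 distinct lines through Q, then Σ m = (q + 1)², Σ m² = (q + 1)(2q + 1)
-- and 3 m ≤ 2 [Q ∈ B] + m², whence 2 ∣ B ∣ ≥ (q + 1)(q + 2), contradicting the first bound as
-- 2 k ≤ q + 1. Conversely, the union of k lines through one point has q k + 1 points and is
-- closed, so it does not percolate.

open import Data.Bool using (Bool; true; false; _∧_; T)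
open import Data.Bool.Properties using (T-≡; T-∧)
open import Data.Empty using (⊥-elim)
open import Data.Fin using (Fin; zero; suc; fromℕ<)
open import Data.Fin.Properties using (_≟_; any?; ¬∀⟶∃¬)
open import Data.Fin.Subset using (Subset; Nonempty; _∈_; _∉_; _⊆_; _∩_; ∣_∣; ⊤; ⊥; inside; outside)
open import Data.Fin.Subset.Properties
  using (_∈?_; ⊥⊆; ∣⊥∣≡0; s⊆s; ∣p∩q∣≤∣p∣; p⊆p∪q; x∈p∪q⁺; x∈p∪q⁻; ⊆-antisym; ⊆⊤;
         p⊂q⇒∣p∣<∣q∣; p⊆q⇒∣p∣≤∣q∣; ∣p∣≤n; ∣⊤∣≡n)
open import Data.List using (allFin)
open import Data.List.Membership.Propositional using (lose)
open import Data.List.Membership.Propositional.Properties using (∈-allFin)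
open import Data.List.Relation.Unary.Any using (satisfied)
open import Data.List.Relation.Unary.Any.Properties using (any⁺; any⁻)
open import Data.Nat using (ℕ; zero; suc; _+_; _*_; _∸_; _⊓_; _≤_; _<_; _≤ᵇ_; _≤?_; z≤n; s≤s; z<s)
open import Data.Nat.Properties hiding (_≟_)
open import Data.Nat.Tactic.RingSolver using (solve-∀)
open import Data.Product using (Σ; ∃; _×_; _,_; proj₁; proj₂)
open import Data.Sum using (_⊎_; inj₁; inj₂)
open import Data.Vec using (_∷_; []; lookup; tabulate)
open import Data.Vec.Properties using (lookup∘tabulate; lookup-zipWith; []=⇒lookup; lookup⇒[]=)
open import Function using (_∘_; Equivalence)
open import Relation.Nullary using (¬_; ¬?; does; yes; no; contradiction)
open import Relation.Nullary.Decidable using (_×-dec_; decidable-stable)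
open import Relation.Binary.PropositionalEquality

open import Algebra.Properties.Semiring.Sum +-*-semiring
  using (sum; sum-syntax; sum-cong-≗; ∑-comm; ∑-distrib-+; *-distribˡ-sum; *-distribʳ-sum)

open import Defs

open Equivalence using (to; from)

sum-mono-≤ : ∀ {n} {f g : Fin n → ℕ} → (∀ i → f i ≤ g i) → sum f ≤ sum g
sum-mono-≤ {zero}  f≤g = z≤n
sum-mono-≤ {suc n} f≤g = +-mono-≤ (f≤g zero) (sum-mono-≤ (f≤g ∘ suc))

term≤sum : ∀ {n} (f : Fin n → ℕ) i → f i ≤ sum f
term≤sum f zero    = m≤m+n (f zero) _
term≤sum f (suc i) = ≤-trans (term≤sum (f ∘ suc) i) (m≤n+m _ (f zero))

sum-const : ∀ n c → ∑[ i < n ] c ≡ n * c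
sum-const zero    c = refl
sum-const (suc n) c = cong (c +_) (sum-const n c)

sum-pos⁻ : ∀ {n} (f : Fin n → ℕ) → 0 < sum f → ∃ λ i → 0 < f i
sum-pos⁻ {suc n} f 0<Σ with f zero in eq
... | suc _ = zero , subst (0 <_) (sym eq) z<s
... | zero  with sum-pos⁻ (f ∘ suc) 0<Σ
...   | i , 0<fi = suc i , 0<fi

toℕ : Bool → ℕ
toℕ true  = 1
toℕ false = 0

toℕ-∧ : ∀ a b → toℕ (a ∧ b) ≡ toℕ a * toℕ b
toℕ-∧ true  b = sym (+-identityʳ (toℕ b))
toℕ-∧ false b = refl

toℕ*-pos⁻ : ∀ b {n} → 0 < toℕ b * n → b ≡ true × 0 < n
toℕ*-pos⁻ true {n} 0<n = refl , subst (0 <_) (+-identityʳ n) 0<n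

toℕ-1≤ᵇ : ∀ m → toℕ (1 ≤ᵇ m) ≡ m ⊓ 1
toℕ-1≤ᵇ zero    = refl
toℕ-1≤ᵇ (suc m) = cong suc (sym (⊓-zeroʳ m))

δ : ∀ {n} → Fin n → Fin n → ℕ
δ i j = toℕ (does (i ≟ j))

δ-≢ : ∀ {n} {i j : Fin n} → i ≢ j → δ i j ≡ 0
δ-≢ {i = i} {j} i≢j with i ≟ j
... | yes i≡j = contradiction i≡j i≢j
... | no _    = refl

δ-pos⁻ : ∀ {n} {i j : Fin n} → 0 < δ i j → i ≡ j
δ-pos⁻ {i = i} {j} 0<δ with i ≟ j
... | yes i≡j = i≡j

sum-δ : ∀ {n} (i : Fin n) (b : Fin n → ℕ) → ∑[ j < n ] (δ i j * b j) ≡ b i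
sum-δ {suc n} zero    b = begin
  b zero + 0 + (∑[ j < n ] 0) ≡⟨ cong₂ _+_ (+-identityʳ (b zero)) (sum-const n 0) ⟩
  b zero + n * 0             ≡⟨ cong (b zero +_) (*-zeroʳ n) ⟩
  b zero + 0                 ≡⟨ +-identityʳ (b zero) ⟩
  b zero                     ∎
  where open ≡-Reasoning
sum-δ {suc n} (suc i) b = sum-δ i (b ∘ suc)

∑-δ : ∀ {n} (i : Fin n) → ∑[ j < n ] δ i j ≡ 1
∑-δ i = trans (sum-cong-≗ (λ j → sym (*-identityʳ (δ i j)))) (sum-δ i (λ _ → 1))

1+q*δ-cases : ∀ {n} q {i j : Fin n} {x} → (i ≡ j → x ≡ suc q) → (i ≢ j → x ≡ 1) → x ≡ 1 + q * δ i j
1+q*δ-cases q {i} {j} same distinct with i ≟ j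
... | yes i≡j = trans (same i≡j) (cong suc (sym (*-identityʳ q)))
... | no  i≢j = trans (distinct i≢j) (cong suc (sym (*-zeroʳ q)))

χ : ∀ {n} → Subset n → Fin n → ℕ
χ p x = toℕ (lookup p x)

∣p∣≡∑χ : ∀ {n} (p : Subset n) → ∣ p ∣ ≡ sum (χ p)
∣p∣≡∑χ []            = refl
∣p∣≡∑χ (inside ∷ p)  = cong suc (∣p∣≡∑χ p)
∣p∣≡∑χ (outside ∷ p) = ∣p∣≡∑χ p

χ-∈ : ∀ {n} {p : Subset n} {x} → x ∈ p → χ p x ≡ 1
χ-∈ x∈p = cong toℕ ([]=⇒lookup x∈p)

χ-∉ : ∀ {n} {p : Subset n} {x} → x ∉ p → χ p x ≡ 0
χ-∉ {p = p} {x} x∉p with lookup p x in eq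
... | true  = contradiction (lookup⇒[]= x p eq) x∉p
... | false = refl

χ-pos⁻ : ∀ {n} (p : Subset n) x → 0 < χ p x → x ∈ p
χ-pos⁻ p x 0<χ with lookup p x in eq
... | true = lookup⇒[]= x p eq

χ*-pos⁻ : ∀ {n} (p : Subset n) x {m} → 0 < χ p x * m → x ∈ p × 0 < m
χ*-pos⁻ p x 0<χm with toℕ*-pos⁻ (lookup p x) 0<χm
... | px≡true , 0<m = lookup⇒[]= x p px≡true , 0<m

χ*χ : ∀ {n} (p : Subset n) x → χ p x * χ p x ≡ χ p x
χ*χ p x with lookup p x
... | true  = refl
... | false = refl

χ-mono : ∀ {n} {p q : Subset n} → p ⊆ q → ∀ x → χ p x ≤ χ q x
χ-mono {p = p} p⊆q x with x ∈? p
... | yes x∈p = ≤-reflexive (trans (χ-∈ x∈p) (sym (χ-∈ (p⊆q x∈p))))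
... | no  x∉p = subst (_≤ _) (sym (χ-∉ x∉p)) z≤n

χ-∩ : ∀ {n} (p q : Subset n) x → χ (p ∩ q) x ≡ χ p x * χ q x
χ-∩ p q x = trans (cong toℕ (lookup-zipWith _∧_ x p q)) (toℕ-∧ (lookup p x) (lookup q x))

χ-tabulate : ∀ {n} (f : Fin n → Bool) x → χ (tabulate f) x ≡ toℕ (f x)
χ-tabulate f x = cong toℕ (lookup∘tabulate f x)

∈⇒T : ∀ {n} {p : Subset n} {x} → x ∈ p → T (lookup p x)
∈⇒T x∈p = from T-≡ ([]=⇒lookup x∈p)

T⇒∈ : ∀ {n} {p : Subset n} {x} → T (lookup p x) → x ∈ p
T⇒∈ {p = p} {x} t = lookup⇒[]= x p (to T-≡ t)

∈-tabulate⁻ : ∀ {n} {f : Fin n → Bool} {x} → x ∈ tabulate f → T (f x)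
∈-tabulate⁻ {f = f} {x} x∈ = subst T (lookup∘tabulate f x) (∈⇒T x∈)

∈-tabulate⁺ : ∀ {n} {f : Fin n → Bool} {x} → T (f x) → x ∈ tabulate f
∈-tabulate⁺ {f = f} {x} t = T⇒∈ (subst T (sym (lookup∘tabulate f x)) t)

0<∣p∣⇒Nonempty : ∀ {n} (p : Subset n) → 0 < ∣ p ∣ → Nonempty p
0<∣p∣⇒Nonempty p 0<∣p∣ with sum-pos⁻ (χ p) (subst (0 <_) (∣p∣≡∑χ p) 0<∣p∣)
... | x , 0<χ = x , χ-pos⁻ p x 0<χ

∃-⊆-of-size : ∀ {n} k (p : Subset n) → k ≤ ∣ p ∣ → ∃ λ s → s ⊆ p × ∣ s ∣ ≡ k
∃-⊆-of-size {n} zero p _ = ⊥ , ⊥⊆ , ∣⊥∣≡0 n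
∃-⊆-of-size (suc k) (inside ∷ p) (s≤s k≤∣p∣) with ∃-⊆-of-size k p k≤∣p∣
... | s , s⊆p , ∣s∣≡k = inside ∷ s , s⊆s s⊆p , cong suc ∣s∣≡k
∃-⊆-of-size (suc k) (outside ∷ p) k<∣p∣ with ∃-⊆-of-size (suc k) p k<∣p∣
... | s , s⊆p , ∣s∣≡k = outside ∷ s , s⊆s s⊆p , ∣s∣≡k

choice-on : ∀ {m n} {S : Subset m} {R : Fin m → Fin n → Set} → Fin n →
  (∀ {x} → x ∈ S → ∃ (R x)) → ∃ λ (f : Fin m → Fin n) → ∀ {x} → x ∈ S → R x (f x)
choice-on {m} {n} {S} {R} default choose = f , f-spec
  where
  f : Fin m → Fin n
  f x with x ∈? S
  ... | yes x∈S = proj₁ (choose x∈S)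
  ... | no  _   = default
  f-spec : ∀ {x} → x ∈ S → R x (f x)
  f-spec {x} x∈S with x ∈? S
  ... | yes x∈S′ = proj₂ (choose x∈S′)
  ... | no  x∉S  = contradiction x∈S x∉S

n≤1⇒n*n≡n : ∀ {n} → n ≤ 1 → n * n ≡ n
n≤1⇒n*n≡n z≤n       = refl
n≤1⇒n*n≡n (s≤s z≤n) = refl

3m≤2+m² : ∀ m → 3 * m ≤ 2 + m * m
3m≤2+m² zero          = z≤n
3m≤2+m² (suc zero)    = ≤-refl
3m≤2+m² (suc (suc i)) = subst (3 * (2 + i) ≤_) (identity i) (m≤m+n (3 * (2 + i)) (i * i + i))
  where
  identity : ∀ i → 3 * (2 + i) + (i * i + i) ≡ 2 + (2 + i) * (2 + i)
  identity = solve-∀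

-- The hypothesis says that the Gram matrix MᵀM is J + qI.
∑-gram : ∀ {n} q (M : Fin n → Fin n → ℕ) →
  (∀ i j → ∑[ l < n ] (M l i * M l j) ≡ 1 + q * δ i j) →
  ∀ i (b : Fin n → ℕ) → ∑[ l < n ] (M l i * ∑[ j < n ] (M l j * b j)) ≡ sum b + q * b i
∑-gram {n} q M gram i b = begin
  ∑[ l < n ] (M l i * ∑[ j < n ] (M l j * b j))
    ≡⟨ sum-cong-≗ (λ l → *-distribˡ-sum (M l i) (λ j → M l j * b j)) ⟩
  ∑[ l < n ] ∑[ j < n ] (M l i * (M l j * b j))
    ≡⟨ ∑-comm (λ l j → M l i * (M l j * b j)) ⟩
  ∑[ j < n ] ∑[ l < n ] (M l i * (M l j * b j))
    ≡⟨ sum-cong-≗ (λ j → sum-cong-≗ {n} (λ l → sym (*-assoc (M l i) (M l j) (b j)))) ⟩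
  ∑[ j < n ] ∑[ l < n ] (M l i * M l j * b j)
    ≡⟨ sum-cong-≗ (λ j → sym (*-distribʳ-sum (b j) (λ l → M l i * M l j))) ⟩
  ∑[ j < n ] (∑[ l < n ] (M l i * M l j) * b j)
    ≡⟨ sum-cong-≗ (λ j → cong (_* b j) (gram i j)) ⟩
  ∑[ j < n ] ((1 + q * δ i j) * b j)
    ≡⟨ sum-cong-≗ (λ j → expand q (δ i j) (b j)) ⟩
  ∑[ j < n ] (b j + q * (δ i j * b j))
    ≡⟨ ∑-distrib-+ b (λ j → q * (δ i j * b j)) ⟩
  sum b + ∑[ j < n ] (q * (δ i j * b j))
    ≡⟨ cong (sum b +_) (sym (*-distribˡ-sum q (λ j → δ i j * b j))) ⟩
  sum b + q * ∑[ j < n ] (δ i j * b j)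
    ≡⟨ cong (λ x → sum b + q * x) (sum-δ i b) ⟩
  sum b + q * b i ∎
  where
  open ≡-Reasoning
  expand : ∀ q d x → (1 + q * d) * x ≡ x + q * (d * x)
  expand = solve-∀

module _ {q : ℕ} (Π : ProjectivePlane q) where
  open ProjectivePlane Π

  N : ℕ
  N = size q

  ι : Fin N → Fin N → ℕ
  ι l = χ (line l)

  ∣line∩∣≡ : ∀ l B → ∣ line l ∩ B ∣ ≡ ∑[ Q < N ] (ι l Q * χ B Q)
  ∣line∩∣≡ l B = trans (∣p∣≡∑χ (line l ∩ B)) (sum-cong-≗ (χ-∩ (line l) B))

  ∑-points-on-line : ∀ l → ∑[ P < N ] ι l P ≡ suc q
  ∑-points-on-line l = trans (sym (∣p∣≡∑χ (line l))) (line-size l)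

  pencil : Fin N → Subset N
  pencil P = tabulate (λ l → lookup (line l) P)

  χ-pencil : ∀ P l → χ (pencil P) l ≡ ι l P
  χ-pencil P l = χ-tabulate (λ l → lookup (line l) P) l

  ∈-pencil⁻ : ∀ {P l} → l ∈ pencil P → P ∈ line l
  ∈-pencil⁻ l∈pencil = T⇒∈ (∈-tabulate⁻ l∈pencil)

  ∑-lines-through-point : ∀ P → ∑[ l < N ] ι l P ≡ suc q
  ∑-lines-through-point P = begin
    ∑[ l < N ] ι l P       ≡⟨ sum-cong-≗ (λ l → sym (χ-pencil P l)) ⟩
    sum (χ (pencil P))     ≡⟨ sym (∣p∣≡∑χ (pencil P)) ⟩
    ∣ pencil P ∣           ≡⟨ point-degree P ⟩
    suc q                  ∎
    where open ≡-Reasoning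

  ∑-meet : ∀ l m → ∑[ Q < N ] (ι l Q * ι m Q) ≡ 1 + q * δ l m
  ∑-meet l m = 1+q*δ-cases q same distinct
    where
    same : l ≡ m → ∑[ Q < N ] (ι l Q * ι m Q) ≡ suc q
    same refl = trans (sum-cong-≗ (λ Q → χ*χ (line l) Q)) (∑-points-on-line l)
    distinct : l ≢ m → ∑[ Q < N ] (ι l Q * ι m Q) ≡ 1
    distinct l≢m = trans (sym (∣line∩∣≡ l (line m))) (lines-meet l m l≢m)

  ∑-join : ∀ P Q → ∑[ l < N ] (ι l P * ι l Q) ≡ 1 + q * δ P Q
  ∑-join P Q = 1+q*δ-cases q same distinct
    where
    same : P ≡ Q → ∑[ l < N ] (ι l P * ι l Q) ≡ suc q
    same refl = trans (sum-cong-≗ (λ l → χ*χ (line l) P)) (∑-lines-through-point P)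
    joining-lines : Subset N
    joining-lines = tabulate (λ l → lookup (line l) P ∧ lookup (line l) Q)
    χ-joining-lines : ∀ l → χ joining-lines l ≡ ι l P * ι l Q
    χ-joining-lines l = trans (χ-tabulate _ l) (toℕ-∧ (lookup (line l) P) (lookup (line l) Q))
    distinct : P ≢ Q → ∑[ l < N ] (ι l P * ι l Q) ≡ 1
    distinct P≢Q = begin
      ∑[ l < N ] (ι l P * ι l Q)  ≡⟨ sum-cong-≗ (λ l → sym (χ-joining-lines l)) ⟩
      sum (χ joining-lines)       ≡⟨ sym (∣p∣≡∑χ joining-lines) ⟩
      ∣ joining-lines ∣           ≡⟨ points-join P Q P≢Q ⟩
      1                           ∎
      where open ≡-Reasoning

  ∑-range : ∀ l (w : Fin N → ℕ) → ∑[ Q < N ] (ι l Q * ∑[ m < N ] (ι m Q * w m)) ≡ sum w + q * w l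
  ∑-range = ∑-gram q (λ Q l → ι l Q) ∑-meet

  ∑-pencil-∩ : ∀ P B → ∑[ l < N ] (ι l P * ∣ line l ∩ B ∣) ≡ ∣ B ∣ + q * χ B P
  ∑-pencil-∩ P B = begin
    ∑[ l < N ] (ι l P * ∣ line l ∩ B ∣)
      ≡⟨ sum-cong-≗ (λ l → cong (ι l P *_) (∣line∩∣≡ l B)) ⟩
    ∑[ l < N ] (ι l P * ∑[ Q < N ] (ι l Q * χ B Q))
      ≡⟨ ∑-gram q ι ∑-join P (χ B) ⟩
    sum (χ B) + q * χ B P
      ≡⟨ cong (_+ q * χ B P) (sym (∣p∣≡∑χ B)) ⟩
    ∣ B ∣ + q * χ B P ∎
    where open ≡-Reasoning

  cover : (Fin N → ℕ) → Fin N → ℕ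
  cover w Q = ∑[ l < N ] (ι l Q * w l)

  cover-support : ∀ w Q → 0 < cover w Q → ∃ λ l → Q ∈ line l × 0 < w l
  cover-support w Q 0<cover with sum-pos⁻ (λ l → ι l Q * w l) 0<cover
  ... | l , 0<ιw = l , χ*-pos⁻ (line l) Q 0<ιw

  ∑-cover : ∀ w → sum (cover w) ≡ suc q * sum w
  ∑-cover w = begin
    ∑[ Q < N ] ∑[ l < N ] (ι l Q * w l)  ≡⟨ ∑-comm (λ Q l → ι l Q * w l) ⟩
    ∑[ l < N ] ∑[ Q < N ] (ι l Q * w l)  ≡⟨ sum-cong-≗ (λ l → sym (*-distribʳ-sum (w l) (ι l))) ⟩
    ∑[ l < N ] (sum (ι l) * w l)         ≡⟨ sum-cong-≗ (λ l → cong (_* w l) (∑-points-on-line l)) ⟩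
    ∑[ l < N ] (suc q * w l)             ≡⟨ sym (*-distribˡ-sum (suc q) w) ⟩
    suc q * sum w                        ∎
    where open ≡-Reasoning

  ∑-cover² : ∀ w → ∑[ Q < N ] (cover w Q * cover w Q) ≡ sum w * sum w + q * ∑[ l < N ] (w l * w l)
  ∑-cover² w = begin
    ∑[ Q < N ] (cover w Q * cover w Q)
      ≡⟨ sum-cong-≗ (λ Q → *-distribʳ-sum (cover w Q) (λ l → ι l Q * w l)) ⟩
    ∑[ Q < N ] ∑[ l < N ] (ι l Q * w l * cover w Q)
      ≡⟨ ∑-comm (λ Q l → ι l Q * w l * cover w Q) ⟩
    ∑[ l < N ] ∑[ Q < N ] (ι l Q * w l * cover w Q)
      ≡⟨ sum-cong-≗ (λ l → sum-cong-≗ {N} (λ Q → swap (ι l Q) (w l) (cover w Q))) ⟩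
    ∑[ l < N ] ∑[ Q < N ] (w l * (ι l Q * cover w Q))
      ≡⟨ sum-cong-≗ (λ l → sym (*-distribˡ-sum (w l) (λ Q → ι l Q * cover w Q))) ⟩
    ∑[ l < N ] (w l * ∑[ Q < N ] (ι l Q * cover w Q))
      ≡⟨ sum-cong-≗ (λ l → cong (w l *_) (∑-range l w)) ⟩
    ∑[ l < N ] (w l * (sum w + q * w l))
      ≡⟨ sum-cong-≗ (λ l → distrib q (w l) (sum w)) ⟩
    ∑[ l < N ] (w l * sum w + q * (w l * w l))
      ≡⟨ ∑-distrib-+ (λ l → w l * sum w) (λ l → q * (w l * w l)) ⟩
    ∑[ l < N ] (w l * sum w) + ∑[ l < N ] (q * (w l * w l))
      ≡⟨ cong₂ _+_ (sym (*-distribʳ-sum (sum w) w)) (sym (*-distribˡ-sum q (λ l → w l * w l))) ⟩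
    sum w * sum w + q * ∑[ l < N ] (w l * w l) ∎
    where
    open ≡-Reasoning
    swap : ∀ i x c → i * x * c ≡ x * (i * c)
    swap = solve-∀
    distrib : ∀ q x s → x * (s + q * x) ≡ x * s + q * (x * x)
    distrib = solve-∀

  -- Closed sets

  Closed : ℕ → Subset N → Set
  Closed r B = ∀ {l} → r ≤ ∣ line l ∩ B ∣ → line l ⊆ B

  closed-missing-point-bound : ∀ {k B X} → Closed (suc k) B → X ∉ B → ∣ B ∣ ≤ suc q * k
  closed-missing-point-bound {k} {B} {X} closed X∉B = begin
    ∣ B ∣                                ≡⟨ sym (+-identityʳ ∣ B ∣) ⟩
    ∣ B ∣ + 0                            ≡⟨ cong (∣ B ∣ +_) (sym (trans (cong (q *_) (χ-∉ X∉B)) (*-zeroʳ q))) ⟩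
    ∣ B ∣ + q * χ B X                    ≡⟨ sym (∑-pencil-∩ X B) ⟩
    ∑[ l < N ] (ι l X * ∣ line l ∩ B ∣)  ≤⟨ sum-mono-≤ poor ⟩
    ∑[ l < N ] (ι l X * k)               ≡⟨ sym (*-distribʳ-sum k (λ l → ι l X)) ⟩
    sum (λ l → ι l X) * k                ≡⟨ cong (_* k) (∑-lines-through-point X) ⟩
    suc q * k                            ∎
    where
    open ≤-Reasoning
    poor : ∀ l → ι l X * ∣ line l ∩ B ∣ ≤ ι l X * k
    poor l with X ∈? line l
    ... | yes X∈l = *-monoʳ-≤ (ι l X) (≮⇒≥ (λ rich → X∉B (closed rich X∈l)))
    ... | no  X∉l rewrite χ-∉ X∉l = z≤n

  ∣line∩∣≤ : ∀ l B → ∣ line l ∩ B ∣ ≤ suc q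
  ∣line∩∣≤ l B = subst (∣ line l ∩ B ∣ ≤_) (line-size l) (∣p∩q∣≤∣p∣ (line l) B)

  rich-line-through : ∀ {k B Y} → k ≤ suc q → q * k + 2 ≤ ∣ B ∣ → Y ∈ B → ∀ l₀ →
    ∃ λ l → l ≢ l₀ × Y ∈ line l × suc k ≤ ∣ line l ∩ B ∣
  rich-line-through {k} {B} {Y} k≤q+1 large Y∈B l₀
    with any? (λ l → ¬? (l ≟ l₀) ×-dec Y ∈? line l ×-dec suc k ≤? ∣ line l ∩ B ∣)
  ... | yes found = found
  ... | no  none  = ⊥-elim (1+n≰n (subst (_≤ suc q * k + suc q) (identity q k)
                      (≤-trans (+-monoˡ-≤ k (+-monoˡ-≤ (q * 1) large)) total)))
    where
    -- Lines through Y other than l₀ meet B in at most k points; the δ l₀ terms absorb the excess of l₀.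
    bound : ∀ l → ι l Y * ∣ line l ∩ B ∣ + δ l₀ l * k ≤ ι l Y * k + δ l₀ l * suc q
    bound l with l₀ ≟ l | Y ∈? line l
    ... | yes refl | yes Y∈l rewrite χ-∈ Y∈l =
      ≤-trans (≤-reflexive (+-comm (∣ line l ∩ B ∣ + 0) (k + 0)))
              (+-monoʳ-≤ (k + 0) (+-monoˡ-≤ 0 (∣line∩∣≤ l B)))
    ... | yes refl | no  Y∉l rewrite χ-∉ Y∉l = +-monoˡ-≤ 0 k≤q+1
    ... | no  l₀≢l | yes Y∈l rewrite χ-∈ Y∈l =
      +-monoˡ-≤ 0 (+-monoˡ-≤ 0 (≮⇒≥ (λ rich → none (l , (λ l≡l₀ → l₀≢l (sym l≡l₀)) , Y∈l , rich))))
    ... | no  _    | no  Y∉l rewrite χ-∉ Y∉l = z≤n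
    total : ∣ B ∣ + q * 1 + k ≤ suc q * k + suc q
    total = begin
      ∣ B ∣ + q * 1 + k
        ≡⟨ cong₂ _+_ (cong (λ x → ∣ B ∣ + q * x) (sym (χ-∈ Y∈B))) (sym (sum-δ l₀ (λ _ → k))) ⟩
      ∣ B ∣ + q * χ B Y + ∑[ l < N ] (δ l₀ l * k)
        ≡⟨ cong (_+ ∑[ l < N ] (δ l₀ l * k)) (sym (∑-pencil-∩ Y B)) ⟩
      ∑[ l < N ] (ι l Y * ∣ line l ∩ B ∣) + ∑[ l < N ] (δ l₀ l * k)
        ≡⟨ sym (∑-distrib-+ (λ l → ι l Y * ∣ line l ∩ B ∣) (λ l → δ l₀ l * k)) ⟩
      ∑[ l < N ] (ι l Y * ∣ line l ∩ B ∣ + δ l₀ l * k)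
        ≤⟨ sum-mono-≤ bound ⟩
      ∑[ l < N ] (ι l Y * k + δ l₀ l * suc q)
        ≡⟨ ∑-distrib-+ (λ l → ι l Y * k) (λ l → δ l₀ l * suc q) ⟩
      ∑[ l < N ] (ι l Y * k) + ∑[ l < N ] (δ l₀ l * suc q)
        ≡⟨ cong₂ _+_ (trans (sym (*-distribʳ-sum k (λ l → ι l Y))) (cong (_* k) (∑-lines-through-point Y)))
                     (sum-δ l₀ (λ _ → suc q)) ⟩
      suc q * k + suc q ∎
      where open ≤-Reasoning
    identity : ∀ q k → q * k + 2 + q * 1 + k ≡ suc (suc q * k + suc q)
    identity = solve-∀

  module _ {B : Subset N} (G : Fin N) (H : Fin N → Fin N)
           (transversal : ∀ {P} → P ∈ line G → H P ≢ G × P ∈ line (H P) × line (H P) ⊆ B) where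

    -- weight h counts the points P of G with H P = h, so cover weight Q counts the lines H P through Q.
    weight : Fin N → ℕ
    weight h = ∑[ P < N ] (ι G P * δ (H P) h)

    ∑-weight : sum weight ≡ suc q
    ∑-weight = begin
      ∑[ h < N ] ∑[ P < N ] (ι G P * δ (H P) h) ≡⟨ ∑-comm (λ h P → ι G P * δ (H P) h) ⟩
      ∑[ P < N ] ∑[ h < N ] (ι G P * δ (H P) h) ≡⟨ sum-cong-≗ (λ P → sym (*-distribˡ-sum (ι G P) (δ (H P)))) ⟩
      ∑[ P < N ] (ι G P * sum (δ (H P)))        ≡⟨ sum-cong-≗ (λ P → cong (ι G P *_) (∑-δ (H P))) ⟩
      ∑[ P < N ] (ι G P * 1)                    ≡⟨ sum-cong-≗ (λ P → *-identityʳ (ι G P)) ⟩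
      sum (ι G)                                 ≡⟨ ∑-points-on-line G ⟩
      suc q                                     ∎
      where open ≡-Reasoning

    weight≤1 : ∀ h → weight h ≤ 1
    weight≤1 h with h ≟ G
    ... | yes refl = begin
      weight G                    ≡⟨ sum-cong-≗ term-G ⟩
      ∑[ P < N ] 0                ≡⟨ trans (sum-const N 0) (*-zeroʳ N) ⟩
      0                           ≤⟨ z≤n ⟩
      1                           ∎
      where
      open ≤-Reasoning
      term-G : ∀ P → ι G P * δ (H P) G ≡ 0
      term-G P with P ∈? line G
      ... | no  P∉G rewrite χ-∉ P∉G = refl
      ... | yes P∈G rewrite δ-≢ (proj₁ (transversal P∈G)) = *-zeroʳ (ι G P)
    ... | no  h≢G  = begin
      weight h                    ≤⟨ sum-mono-≤ term≤ ⟩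
      ∑[ P < N ] (ι G P * ι h P)  ≡⟨ ∑-meet G h ⟩
      1 + q * δ G h               ≡⟨ cong (λ d → 1 + q * d) (δ-≢ (h≢G ∘ sym)) ⟩
      1 + q * 0                   ≡⟨ cong suc (*-zeroʳ q) ⟩
      1                           ∎
      where
      open ≤-Reasoning
      term≤ : ∀ P → ι G P * δ (H P) h ≤ ι G P * ι h P
      term≤ P with P ∈? line G
      ... | no  P∉G rewrite χ-∉ P∉G = z≤n
      ... | yes P∈G with H P ≟ h
      ...   | yes refl = *-monoʳ-≤ (ι G P) (≤-reflexive (sym (χ-∈ (proj₁ (proj₂ (transversal P∈G))))))
      ...   | no  _    = ≤-trans (≤-reflexive (*-zeroʳ (ι G P))) z≤n

    covered⇒∈B : ∀ Q → 0 < cover weight Q → Q ∈ B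
    covered⇒∈B Q 0<cover with cover-support weight Q 0<cover
    ... | h , Q∈h , 0<weight with sum-pos⁻ (λ P → ι G P * δ (H P) h) 0<weight
    ...   | P , 0<ιδ with χ*-pos⁻ (line G) P 0<ιδ
    ...     | P∈G , 0<δ with δ-pos⁻ {i = H P} {j = h} 0<δ
    ...       | refl = proj₂ (proj₂ (transversal P∈G)) Q∈h

    transversals-cover : suc q * (2 + q) ≤ 2 * ∣ B ∣
    transversals-cover = +-cancelʳ-≤ (suc q * suc q + q * suc q) _ _
      (≤-trans (≤-reflexive (identity q)) second-moment)
      where
      open ≤-Reasoning
      m : Fin N → ℕ
      m = cover weight
      pointwise : ∀ Q → 3 * m Q ≤ 2 * χ B Q + m Q * m Q
      pointwise Q with Q ∈? B
      ... | yes Q∈B rewrite χ-∈ Q∈B = 3m≤2+m² (m Q)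
      ... | no  Q∉B = ≤-trans (*-monoʳ-≤ 3 (≮⇒≥ (Q∉B ∘ covered⇒∈B Q))) z≤n
      second-moment : 3 * (suc q * suc q) ≤ 2 * ∣ B ∣ + (suc q * suc q + q * suc q)
      second-moment = begin
        3 * (suc q * suc q)
          ≡⟨ cong (3 *_) (sym (trans (∑-cover weight) (cong (suc q *_) ∑-weight))) ⟩
        3 * sum m
          ≡⟨ *-distribˡ-sum 3 m ⟩
        ∑[ Q < N ] (3 * m Q)
          ≤⟨ sum-mono-≤ pointwise ⟩
        ∑[ Q < N ] (2 * χ B Q + m Q * m Q)
          ≡⟨ ∑-distrib-+ (λ Q → 2 * χ B Q) (λ Q → m Q * m Q) ⟩
        ∑[ Q < N ] (2 * χ B Q) + ∑[ Q < N ] (m Q * m Q)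
          ≡⟨ cong₂ _+_ (trans (sym (*-distribˡ-sum 2 (χ B))) (cong (2 *_) (sym (∣p∣≡∑χ B)))) (∑-cover² weight) ⟩
        2 * ∣ B ∣ + (sum weight * sum weight + q * ∑[ h < N ] (weight h * weight h))
          ≡⟨ cong₂ (λ s t → 2 * ∣ B ∣ + (s * s + q * t)) ∑-weight
                   (trans (sum-cong-≗ (λ h → n≤1⇒n*n≡n (weight≤1 h))) ∑-weight) ⟩
        2 * ∣ B ∣ + (suc q * suc q + q * suc q) ∎
      identity : ∀ q → suc q * (2 + q) + (suc q * suc q + q * suc q) ≡ 3 * (suc q * suc q)
      identity = solve-∀

  large-closed-set-bound : ∀ {k B} → k ≤ suc q → Closed (suc k) B → q * k + 2 ≤ ∣ B ∣ →
    suc q * (2 + q) ≤ 2 * ∣ B ∣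
  large-closed-set-bound {k} {B} k≤q+1 closed large
    with 0<∣p∣⇒Nonempty B (≤-trans (s≤s z≤n) (≤-trans (m≤n+m 2 (q * k)) large))
  ... | Y , Y∈B
    -- Points and lines share the index type Fin N; the excluded line is immaterial here.
    with rich-line-through k≤q+1 large Y∈B Y
  ... | G , _ , _ , G-rich
    with choice-on G (λ P∈G → rich-line-through k≤q+1 large (closed G-rich P∈G) G)
  ... | H , H-rich = transversals-cover G H λ P∈G →
    let (H≢G , P∈H , rich) = H-rich P∈G in H≢G , P∈H , closed rich

  closed-set-bound : ∀ {k B X} → 2 * k ≤ suc q → Closed (suc k) B → X ∉ B → ∣ B ∣ ≤ q * k + 1
  closed-set-bound {k} {B} 2k≤q+1 closed X∉B with ∣ B ∣ ≤? q * k + 1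
  ... | yes small = small
  ... | no  ¬small = ⊥-elim (1+n≰n (*-cancelˡ-≤ (suc q) (≤-trans lower upper)))
    where
    lower : suc q * (2 + q) ≤ 2 * ∣ B ∣
    lower = large-closed-set-bound (≤-trans (m≤m+n k (k + 0)) 2k≤q+1) closed
              (subst (_≤ ∣ B ∣) (sym (+-suc (q * k) 1)) (≰⇒> ¬small))
    upper : 2 * ∣ B ∣ ≤ suc q * suc q
    upper = begin
      2 * ∣ B ∣           ≤⟨ *-monoʳ-≤ 2 (closed-missing-point-bound closed X∉B) ⟩
      2 * (suc q * k)     ≡⟨ swap 2 (suc q) k ⟩
      suc q * (2 * k)     ≤⟨ *-monoʳ-≤ (suc q) 2k≤q+1 ⟩
      suc q * suc q       ∎
      where
      open ≤-Reasoning
      swap : ∀ a b c → a * (b * c) ≡ b * (a * c)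
      swap = solve-∀

  -- Percolation ends in a closed set

  module _ (r : ℕ) where

    ∈-step⁻ : ∀ {A P} → P ∈ step Π r A → P ∈ A ⊎ ∃ λ l → P ∈ line l × r ≤ ∣ line l ∩ A ∣
    ∈-step⁻ {A} P∈step with x∈p∪q⁻ A _ P∈step
    ... | inj₁ P∈A   = inj₁ P∈A
    ... | inj₂ P∈new with satisfied (any⁻ _ (allFin N) (∈-tabulate⁻ P∈new))
    ...   | l , P∈l∧rich with to T-∧ P∈l∧rich
    ...     | P∈l , rich = inj₂ (l , T⇒∈ P∈l , ≤ᵇ⇒≤ r _ rich)

    ∈-step⁺ : ∀ {A P l} → P ∈ line l → r ≤ ∣ line l ∩ A ∣ → P ∈ step Π r A
    ∈-step⁺ {l = l} P∈l rich =
      x∈p∪q⁺ (inj₂ (∈-tabulate⁺ (any⁺ _ (lose (∈-allFin l) (from T-∧ (∈⇒T P∈l , ≤⇒≤ᵇ rich))))))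

    step⊆⇒closed : ∀ {B} → step Π r B ⊆ B → Closed r B
    step⊆⇒closed step⊆B rich P∈l = step⊆B (∈-step⁺ P∈l rich)

    closed⇒step⊆ : ∀ {B} → Closed r B → step Π r B ⊆ B
    closed⇒step⊆ closed P∈step with ∈-step⁻ P∈step
    ... | inj₁ P∈B              = P∈B
    ... | inj₂ (l , P∈l , rich) = closed rich P∈l

    closed⇒iter≡ : ∀ {B} → Closed r B → ∀ i → iter Π r i B ≡ B
    closed⇒iter≡ closed zero    = refl
    closed⇒iter≡ closed (suc i) rewrite closed⇒iter≡ closed i = ⊆-antisym (closed⇒step⊆ closed) (p⊆p∪q _)

    ⊆-iter : ∀ {A} i → A ⊆ iter Π r i A
    ⊆-iter zero    = λ x∈A → x∈A
    ⊆-iter (suc i) = p⊆p∪q _ ∘ ⊆-iter i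

    closed⊎grows : ∀ B → Closed r B ⊎ ∣ B ∣ < ∣ step Π r B ∣
    closed⊎grows B with any? (λ P → P ∈? step Π r B ×-dec ¬? (P ∈? B))
    ... | yes (P , P∈step , P∉B) = inj₂ (p⊂q⇒∣p∣<∣q∣ (p⊆p∪q _ , P , P∈step , P∉B))
    ... | no  nothing-new        = inj₁ (step⊆⇒closed λ {P} P∈step →
      decidable-stable (P ∈? B) (λ P∉B → nothing-new (P , P∈step , P∉B)))

    closed-or-large : ∀ A i → (∃ λ j → Closed r (iter Π r j A)) ⊎ i ≤ ∣ iter Π r i A ∣
    closed-or-large A zero = inj₂ z≤n
    closed-or-large A (suc i) with closed-or-large A i
    ... | inj₁ closes = inj₁ closes
    ... | inj₂ i≤∣Aᵢ∣ with closed⊎grows (iter Π r i A)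
    ...   | inj₁ closed = inj₁ (i , closed)
    ...   | inj₂ grows  = inj₂ (≤-<-trans i≤∣Aᵢ∣ grows)

    closure : ∀ A → ∃ λ i → Closed r (iter Π r i A)
    closure A with closed-or-large A (suc N)
    ... | inj₁ closes = closes
    ... | inj₂ N<∣A∣  = contradiction (∣p∣≤n (iter Π r (suc N) A)) (<⇒≱ N<∣A∣)

    closed⇒¬percolates : ∀ {B} → Closed r B → ∣ B ∣ < N → ¬ Percolates Π r B
    closed⇒¬percolates {B} closed ∣B∣<N (i , Bᵢ≡⊤) = <⇒≢ ∣B∣<N (begin
      ∣ B ∣              ≡⟨ cong ∣_∣ (sym (closed⇒iter≡ closed i)) ⟩
      ∣ iter Π r i B ∣   ≡⟨ cong ∣_∣ Bᵢ≡⊤ ⟩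
      ∣ ⊤ {N} ∣          ≡⟨ ∣⊤∣≡n N ⟩
      N                  ∎)
      where open ≡-Reasoning

    ¬percolates⇒closed-superset : ∀ {A} → ¬ Percolates Π r A →
      ∃ λ B → A ⊆ B × Closed r B × ∃ λ X → X ∉ B
    ¬percolates⇒closed-superset {A} ¬perc with closure A
    ... | i , closed = iter Π r i A , ⊆-iter i , closed ,
      ¬∀⟶∃¬ N (_∈ iter Π r i A) (_∈? iter Π r i A) (λ all∈ → ¬perc (i , ⊆-antisym ⊆⊤ (λ {P} _ → all∈ P)))

  -- Unions of concurrent lines

  lines-union : Subset N → Subset N
  lines-union L = tabulate (λ Q → 1 ≤ᵇ cover (χ L) Q)

  χ-lines-union : ∀ L Q → χ (lines-union L) Q ≡ cover (χ L) Q ⊓ 1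
  χ-lines-union L Q = trans (χ-tabulate (λ Q → 1 ≤ᵇ cover (χ L) Q) Q) (toℕ-1≤ᵇ (cover (χ L) Q))

  lines-union-closed : ∀ L → Closed (suc ∣ L ∣) (lines-union L)
  lines-union-closed L {l} rich {P} P∈l with l ∈? L
  ... | yes l∈L = χ-pos⁻ (lines-union L) P
    (≤-reflexive (sym (trans (χ-lines-union L P) (m≥n⇒m⊓n≡n covered))))
    where
    covered : 1 ≤ cover (χ L) P
    covered = ≤-trans (≤-reflexive (sym (cong₂ _*_ (χ-∈ P∈l) (χ-∈ l∈L))))
                      (term≤sum (λ l′ → ι l′ P * χ L l′) l)
  ... | no  l∉L = ⊥-elim (<⇒≱ rich (begin
    ∣ line l ∩ lines-union L ∣                ≡⟨ ∣line∩∣≡ l (lines-union L) ⟩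
    ∑[ Q < N ] (ι l Q * χ (lines-union L) Q)  ≤⟨ sum-mono-≤ (λ Q → *-monoʳ-≤ (ι l Q) (χ≤cover Q)) ⟩
    ∑[ Q < N ] (ι l Q * cover (χ L) Q)        ≡⟨ ∑-range l (χ L) ⟩
    sum (χ L) + q * χ L l                     ≡⟨ cong₂ (λ s t → s + q * t) (sym (∣p∣≡∑χ L)) (χ-∉ l∉L) ⟩
    ∣ L ∣ + q * 0                             ≡⟨ cong (∣ L ∣ +_) (*-zeroʳ q) ⟩
    ∣ L ∣ + 0                                 ≡⟨ +-identityʳ ∣ L ∣ ⟩
    ∣ L ∣                                     ∎))
    where
    open ≤-Reasoning
    χ≤cover : ∀ Q → χ (lines-union L) Q ≤ cover (χ L) Q
    χ≤cover Q = subst (_≤ cover (χ L) Q) (sym (χ-lines-union L Q)) (m⊓n≤m (cover (χ L) Q) 1)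

  ∣lines-union∣ : ∀ {j L P₀} → L ⊆ pencil P₀ → ∣ L ∣ ≡ suc j → ∣ lines-union L ∣ ≡ q * suc j + 1
  ∣lines-union∣ {j} {L} {P₀} L⊆pencil ∣L∣≡k = +-cancelʳ-≡ j _ _ (begin-equality
    ∣ A ∣ + j                               ≡⟨ cong₂ _+_ (∣p∣≡∑χ A) (sym (sum-δ P₀ (λ _ → j))) ⟩
    sum (χ A) + ∑[ Q < N ] (δ P₀ Q * j)     ≡⟨ sym (∑-distrib-+ (χ A) (λ Q → δ P₀ Q * j)) ⟩
    ∑[ Q < N ] (χ A Q + δ P₀ Q * j)         ≡⟨ sum-cong-≗ χA+excess ⟩
    sum m                                   ≡⟨ ∑-cover (χ L) ⟩
    suc q * sum (χ L)                       ≡⟨ cong (suc q *_) ∑χL ⟩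
    suc q * suc j                           ≡⟨ identity q j ⟩
    q * suc j + 1 + j                       ∎)
    where
    open ≤-Reasoning
    A : Subset N
    A = lines-union L
    m : Fin N → ℕ
    m = cover (χ L)
    ∑χL : sum (χ L) ≡ suc j
    ∑χL = trans (sym (∣p∣≡∑χ L)) ∣L∣≡k
    χL≤ι : ∀ l → χ L l ≤ ι l P₀
    χL≤ι l = subst (χ L l ≤_) (χ-pencil P₀ l) (χ-mono L⊆pencil l)
    ιχL≡χL : ∀ l → ι l P₀ * χ L l ≡ χ L l
    ιχL≡χL l with l ∈? L
    ... | yes l∈L rewrite χ-∈ l∈L | χ-∈ (∈-pencil⁻ (L⊆pencil l∈L)) = refl
    ... | no  l∉L rewrite χ-∉ l∉L = *-zeroʳ (ι l P₀)
    m-P₀ : m P₀ ≡ suc j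
    m-P₀ = trans (sum-cong-≗ ιχL≡χL) ∑χL
    m≤1 : ∀ {Q} → P₀ ≢ Q → m Q ≤ 1
    m≤1 {Q} P₀≢Q = begin
      m Q                          ≤⟨ sum-mono-≤ term≤ ⟩
      ∑[ l < N ] (ι l P₀ * ι l Q)  ≡⟨ ∑-join P₀ Q ⟩
      1 + q * δ P₀ Q               ≡⟨ cong (λ d → 1 + q * d) (δ-≢ P₀≢Q) ⟩
      1 + q * 0                    ≡⟨ cong suc (*-zeroʳ q) ⟩
      1                            ∎
      where
      term≤ : ∀ l → ι l Q * χ L l ≤ ι l P₀ * ι l Q
      term≤ l = ≤-trans (*-monoʳ-≤ (ι l Q) (χL≤ι l)) (≤-reflexive (*-comm (ι l Q) (ι l P₀)))
    -- P₀ lies on all suc j lines of L, every other covered point on exactly one.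
    χA+excess : ∀ Q → χ A Q + δ P₀ Q * j ≡ m Q
    χA+excess Q with P₀ ≟ Q
    ... | yes refl = begin-equality
      χ A P₀ + (j + 0)    ≡⟨ cong (_+ (j + 0)) (χ-lines-union L P₀) ⟩
      m P₀ ⊓ 1 + (j + 0)  ≡⟨ cong₂ _+_ (trans (cong (_⊓ 1) m-P₀) (m≥n⇒m⊓n≡n (s≤s z≤n))) (+-identityʳ j) ⟩
      suc j               ≡⟨ sym m-P₀ ⟩
      m P₀                ∎
    ... | no  P₀≢Q = begin-equality
      χ A Q + 0         ≡⟨ +-identityʳ (χ A Q) ⟩
      χ A Q             ≡⟨ χ-lines-union L Q ⟩
      m Q ⊓ 1           ≡⟨ m≤n⇒m⊓n≡m (m≤1 P₀≢Q) ⟩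
      m Q               ∎
    identity : ∀ q j → suc q * suc j ≡ q * suc j + 1 + j
    identity = solve-∀

  pencil-union : ∀ {j} (P₀ : Fin N) → suc j ≤ suc q →
    ∃ λ A → Closed (suc (suc j)) A × ∣ A ∣ ≡ q * suc j + 1
  pencil-union {j} P₀ k≤q+1
    with ∃-⊆-of-size (suc j) (pencil P₀) (subst (suc j ≤_) (sym (point-degree P₀)) k≤q+1)
  ... | L , L⊆pencil , ∣L∣≡k =
    lines-union L , subst (λ s → Closed (suc s) (lines-union L)) ∣L∣≡k (lines-union-closed L) ,
    ∣lines-union∣ L⊆pencil ∣L∣≡k

proposition10 : (q : ℕ) → 2 ≤ q → (Π : ProjectivePlane q) → (r : ℕ) →
    3 ≤ r → 2 * r < q + 4 →
    IsMaxNonPercolating Π r (q * (r ∸ 1) + 1)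
proposition10 q _   Π zero          ()              _
proposition10 q _   Π (suc zero)    (s≤s ())        _
proposition10 q 2≤q Π (suc k@(suc j)) _ 2r<q+4 = lower-bound , upper-bound
  where
  2k≤q+1 : 2 * k ≤ suc q
  2k≤q+1 = +-cancelʳ-≤ 3 (2 * k) (suc q) (subst₂ _≤_ (e₁ k) (e₂ q) 2r<q+4)
    where
    e₁ : ∀ k → suc (2 * suc k) ≡ 2 * k + 3
    e₁ = solve-∀
    e₂ : ∀ q → q + 4 ≡ suc q + 3
    e₂ = solve-∀
  k≤q : k ≤ q
  k≤q = ≤-trans (≤-trans (m≤m+n k 0) (m≤n+m (k + 0) j)) (≤-pred 2k≤q+1)
  qk+1<N : q * k + 1 < size q
  qk+1<N = +-monoˡ-< 1 (≤-<-trans (*-monoʳ-≤ q k≤q) (m<m+n (q * q) (≤-trans (s≤s z≤n) 2≤q)))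
  lower-bound : Σ (Subset (size q)) λ A → ¬ Percolates Π (suc k) A × ∣ A ∣ ≡ q * k + 1
  lower-bound with pencil-union Π (fromℕ< (m≤n+m 1 (q * q + q))) (≤-trans (m≤m+n k (k + 0)) 2k≤q+1)
  ... | A , closed , ∣A∣≡ = A , closed⇒¬percolates Π (suc k) closed (subst (_< size q) (sym ∣A∣≡) qk+1<N) , ∣A∣≡
  upper-bound : ∀ A → ¬ Percolates Π (suc k) A → ∣ A ∣ ≤ q * k + 1
  upper-bound A ¬perc with ¬percolates⇒closed-superset Π (suc k) ¬perc
  ... | B , A⊆B , closed , X , X∉B = ≤-trans (p⊆q⇒∣p∣≤∣q∣ A⊆B) (closed-set-bound Π 2k≤q+1 closed X∉B)
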